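{- Let $G=([n],E)$ be a natural unit interval graph, let $A\subseteq[n]$ be nonempty, and for $i\in A$ let $b_i(A)$ be the number of $j\in A$ with $j<i$ and $\{j,i\}\in E$. Then $$\sum_{\sigma}q^{\mathrm{inv}_G(\sigma)}=\prod_{i\in A,\ i>\min A}[b_i(A)]_q,$$ where the sum is over all tree lists $\sigma$ of $G$ that are permutations of $A$.
   Context: A graph $G=([n],E)$ is a natural unit interval graph if for all $1\le i<j<k\le n$, $\{i,k\}\in E$ implies $\{i,j\}\in E$ and $\{j,k\}\in E$. For a nonempty $A\subseteq[n]$, a tree list of $G$ on $A$ is a permutation $\sigma=\sigma_1\cdots\sigma_h$ of $A$ with $\sigma_1=\min A$ such that: whenever $\sigma_i>\sigma_{i+1}$ we have $\{\sigma_{i+1},\sigma_i\}\in E$; and if $a_1<\dots<a_s$ are the left-to-right maxima of $\sigma$ (entries $\sigma_j$ with $\sigma_j>\sigma_i$ for all $i<j$), then $\{a_i,a_{i+1}\}\in E$ for $1\le i\le s-1$. $\mathrm{inv}_G(\sigma)=|\{(i,j):i<j,\ \sigma_i>\sigma_j,\ \{\sigma_j,\sigma_i\}\in E\}|$. $[k]_q=1+q+\dots+q^{k-1}$ (so $[0]_q=0$). -}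

module Defs where

open import Data.Bool using (Bool; true; false; _∧_; if_then_else_)
open import Data.Nat as ℕ using (ℕ; zero; suc; _+_; _<ᵇ_)
open import Data.Fin using (Fin; toℕ)
open import Relation.Binary.PropositionalEquality using (_≡_)
open import Data.Fin.Subset using (Subset)
open import Data.Fin.Subset.Properties using (_∈?_)
open import Data.List using (List; []; _∷_; [_]; map; concatMap; filter; filterᵇ; length; foldr; replicate; _++_; allFin)

-- Vertices of G are Fin n (vertex k of the paper's [n] is Fin index k-1;
-- the order is that of toℕ).  A simple graph on the vertex set is given by
-- a Boolean adjacency function; the statement assumes it is symmetric and
-- irreflexive, so that  E i j  means  {i,j} ∈ E.
Graph : ℕ → Set
Graph n = Fin n → Fin n → Bool

module _ {n : ℕ} where

  _<ᵥ_ : Fin n → Fin n → Bool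
  i <ᵥ j = toℕ i <ᵇ toℕ j

  elems : Subset n → List (Fin n)
  elems A = filter (_∈? A) (allFin n)

  insertions : Fin n → List (Fin n) → List (List (Fin n))
  insertions x []       = [ x ∷ [] ]
  insertions x (y ∷ ys) = (x ∷ y ∷ ys) ∷ map (y ∷_) (insertions x ys)

  perms : List (Fin n) → List (List (Fin n))
  perms []       = [] ∷ []
  perms (x ∷ xs) = concatMap (insertions x) (perms xs)

  -- σ_1 = min A (the head of the increasing list of elements of A)
  sameHead : List (Fin n) → List (Fin n) → Bool
  sameHead (x ∷ _) (y ∷ _) = toℕ x ℕ.≡ᵇ toℕ y
  sameHead _       _       = false

  descentsOK : Graph n → List (Fin n) → Bool
  descentsOK E (x ∷ y ∷ xs) = (if y <ᵥ x then E y x else true) ∧ descentsOK E (y ∷ xs)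
  descentsOK E _            = true

  ltrMaxFrom : Fin n → List (Fin n) → List (Fin n)
  ltrMaxFrom m []       = []
  ltrMaxFrom m (x ∷ xs) = if m <ᵥ x then x ∷ ltrMaxFrom x xs else ltrMaxFrom m xs

  ltrMax : List (Fin n) → List (Fin n)
  ltrMax []       = []
  ltrMax (x ∷ xs) = x ∷ ltrMaxFrom x xs

  chainOK : Graph n → List (Fin n) → Bool
  chainOK E (x ∷ y ∷ xs) = E x y ∧ chainOK E (y ∷ xs)
  chainOK E _            = true

  isTreeList : Graph n → Subset n → List (Fin n) → Bool
  isTreeList E A σ = sameHead σ (elems A) ∧ descentsOK E σ ∧ chainOK E (ltrMax σ)

  treeLists : Graph n → Subset n → List (List (Fin n))
  treeLists E A = filterᵇ (isTreeList E A) (perms (elems A))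

  count : (Fin n → Bool) → List (Fin n) → ℕ
  count p xs = length (filterᵇ p xs)

  invG : Graph n → List (Fin n) → ℕ
  invG E []       = 0
  invG E (x ∷ xs) = count (λ y → (y <ᵥ x) ∧ E y x) xs + invG E xs

  bA : Graph n → Subset n → Fin n → ℕ
  bA E A i = count (λ j → (j <ᵥ i) ∧ E j i) (elems A)

  aboveMin : List (Fin n) → List (Fin n)
  aboveMin []       = []
  aboveMin (m ∷ xs) = filterᵇ (m <ᵥ_) (m ∷ xs)

-- Polynomials in q with ℕ coefficients, as coefficient lists (index k = coeff of q^k)
Poly : Set
Poly = List ℕ

_⊕_ : Poly → Poly → Poly
[]       ⊕ q        = q
(a ∷ p)  ⊕ []       = a ∷ p
(a ∷ p)  ⊕ (b ∷ q)  = (a + b) ∷ (p ⊕ q)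

scale : ℕ → Poly → Poly
scale c = map (c ℕ.*_)

_⊗_ : Poly → Poly → Poly
[]      ⊗ q = []
(a ∷ p) ⊗ q = scale a q ⊕ (0 ∷ (p ⊗ q))

one : Poly
one = 1 ∷ []

qpow : ℕ → Poly
qpow k = replicate k 0 ++ (1 ∷ [])

qint : ℕ → Poly
qint k = replicate k 1

coeff : Poly → ℕ → ℕ
coeff []      _       = 0
coeff (a ∷ p) zero    = a
coeff (a ∷ p) (suc k) = coeff p k

_≈ₚ_ : Poly → Poly → Set
p ≈ₚ r = ∀ k → coeff p k ≡ coeff r k

sumP : List Poly → Poly
sumP = foldr _⊕_ []

prodP : List Poly → Poly
prodP = foldr _⊗_ one

-- Let m be the largest element of A. Deleting m from a tree list on A leaves a tree list τ on
-- A ∖ {m}; conversely, inserting m into τ gives a tree list exactly when the largest entry before m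
-- and the entry right after m (if any) are neighbours of m. By the unit-interval property the
-- smaller neighbours of m form a final segment of A ∖ {m}, and walking along τ while tracking the
-- last entry and the running maximum shows that the admissible insertions create 0, 1, …,
-- b_m(A) − 1 new inversions, one each. Hence they contribute q ^ inv(τ) · [b_m(A)]_q, and induction
-- on |A| gives the product.

module Submission where

open import Algebra.Bundles using (CommutativeMonoid)
open import Algebra.Structures using (IsCommutativeMonoid)
open import Data.Bool using (Bool; true; false; _∧_; if_then_else_; T)
open import Data.Bool.Properties
  using (T-≡; ¬-not; ∧-commutativeMonoid; ∧-identityʳ; ∧-conicalˡ; ∧-conicalʳ)
open import Data.Empty using (⊥-elim)
open import Data.Fin as Fin using (Fin; toℕ; _<_; _≤_)
open import Data.Fin.Properties using (toℕ-injective; ≤-refl)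
open import Data.Fin.Subset using (Subset; Nonempty)
open import Data.Fin.Subset.Properties using (_∈?_)
open import Data.List
  using (List; []; _∷_; [_]; _++_; _∷ʳ_; map; concatMap; filterᵇ; foldr; length; replicate; tabulate;
         downFrom; applyDownFrom)
open import Data.List.Properties
  using (map-∘; map-cong; map-cong-local; map-++; map-downFrom; downFrom-∷ʳ; concatMap-++; foldr-∷ʳ;
         filter-accept; filter-reject; filter-none; filter-++)
open import Data.List.Membership.Propositional using (_∈_)
open import Data.List.Membership.Propositional.Properties using (∈-map⁻; ∈-filter⁺; ∈-allFin)
open import Data.List.Relation.Unary.All as All using (All; []; _∷_)
import Data.List.Relation.Unary.All.Properties as AllP
open import Data.List.Relation.Unary.AllPairs using (AllPairs; []; _∷_)
import Data.List.Relation.Unary.AllPairs.Properties as AllPairsP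
open import Data.List.Relation.Unary.Any using (here; there)
open import Data.List.Relation.Binary.Permutation.Propositional
  using (_↭_; refl; prep; swap; trans; ↭-refl; ↭-sym; ↭-trans; ↭⇒↭ₛ; module PermutationReasoning)
open import Data.List.Relation.Binary.Permutation.Propositional.Properties
  using (map⁺; ∷↭∷ʳ; ++⁺ˡ; ++⁺; shifts; ↭-length; filter-↭; All-resp-↭)
open import Data.List.Reverse using (Reverse; []; _∶_∶ʳ_; reverseView)
open import Data.Nat as ℕ using (ℕ; zero; suc; _+_; _*_; _≡ᵇ_; z<s; s<s)
open import Data.Nat.Properties
  using (+-comm; +-assoc; +-identityʳ; *-identityˡ; <⇒≤; <⇒≢; <⇒≱; ≮⇒≥; m≤n⇒m<n∨m≡n;
         <ᵇ-reflects-<; <⇒<ᵇ; ≡ᵇ⇒≡; ≡⇒≡ᵇ)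
open import Data.Product using (_×_; _,_; proj₁; proj₂)
open import Data.Sum using (_⊎_; inj₁; inj₂)
open import Function using (_∘_; id; Equivalence)
open import Relation.Binary.Bundles using (Setoid)
import Relation.Binary.Reasoning.Setoid
open import Relation.Binary.PropositionalEquality as ≡ using (_≡_; _≢_; refl; cong; cong₂)
open import Relation.Nullary.Decidable using (T?)
open import Relation.Nullary.Reflects using (Reflects; ofʸ; ofⁿ)

open import Defs

open import Algebra.Properties.CommutativeSemigroup
  (CommutativeMonoid.commutativeSemigroup ∧-commutativeMonoid) using (interchange)

-- Polynomials

⊕-identityʳ : ∀ p → p ⊕ [] ≡ p
⊕-identityʳ []      = refl
⊕-identityʳ (a ∷ p) = refl

⊕-comm : ∀ p r → p ⊕ r ≡ r ⊕ p
⊕-comm []      []      = refl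
⊕-comm []      (b ∷ r) = refl
⊕-comm (a ∷ p) []      = refl
⊕-comm (a ∷ p) (b ∷ r) = cong₂ _∷_ (+-comm a b) (⊕-comm p r)

⊕-assoc : ∀ p r s → (p ⊕ r) ⊕ s ≡ p ⊕ (r ⊕ s)
⊕-assoc []      r       s       = refl
⊕-assoc (a ∷ p) []      s       = refl
⊕-assoc (a ∷ p) (b ∷ r) []      = refl
⊕-assoc (a ∷ p) (b ∷ r) (c ∷ s) = cong₂ _∷_ (+-assoc a b c) (⊕-assoc p r s)

⊕-isCommutativeMonoid : IsCommutativeMonoid _≡_ _⊕_ []
⊕-isCommutativeMonoid = record
  { isMonoid = record
    { isSemigroup = record
      { isMagma = record { isEquivalence = ≡.isEquivalence ; ∙-cong = cong₂ _⊕_ }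
      ; assoc   = ⊕-assoc
      }
    ; identity = (λ _ → refl) , ⊕-identityʳ
    }
  ; comm = ⊕-comm
  }

open import Data.List.Relation.Binary.Permutation.Setoid.Properties (≡.setoid Poly)
  using (foldr-commMonoid)

∑ : {A : Set} → (A → Poly) → List A → Poly
∑ g xs = sumP (map g xs)

infix 5 ∑
syntax ∑ (λ x → g) xs = ∑[ x ∈ xs ] g

module _ {A : Set} (g : A → Poly) where

  ∑-↭ : ∀ {xs ys} → xs ↭ ys → ∑ g xs ≡ ∑ g ys
  ∑-↭ xs↭ys = foldr-commMonoid ⊕-isCommutativeMonoid (↭⇒↭ₛ (map⁺ g xs↭ys))

  ∑-++ : ∀ xs ys → ∑ g (xs ++ ys) ≡ ∑ g xs ⊕ ∑ g ys
  ∑-++ []       ys = refl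
  ∑-++ (x ∷ xs) ys = ≡.trans (cong (g x ⊕_) (∑-++ xs ys)) (≡.sym (⊕-assoc (g x) _ _))

  ∑-concatMap : ∀ {B : Set} (f : B → List A) xs →
                ∑ g (concatMap f xs) ≡ (∑[ x ∈ xs ] ∑ g (f x))
  ∑-concatMap f []       = refl
  ∑-concatMap f (x ∷ xs) =
    ≡.trans (∑-++ (f x) (concatMap f xs)) (cong (∑ g (f x) ⊕_) (∑-concatMap f xs))

  ∑-filterᵇ : ∀ (p : A → Bool) xs →
              ∑ g (filterᵇ p xs) ≡ (∑[ x ∈ xs ] (if p x then g x else []))
  ∑-filterᵇ p []       = refl
  ∑-filterᵇ p (x ∷ xs) with p x
  ... | true  = cong (g x ⊕_) (∑-filterᵇ p xs)
  ... | false = ∑-filterᵇ p xs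

∑-map : ∀ {A B : Set} (g : B → Poly) (f : A → B) xs → ∑ g (map f xs) ≡ (∑[ x ∈ xs ] g (f x))
∑-map g f xs = cong sumP (≡.sym (map-∘ xs))

-- ⊕ obeys its laws up to ≡, but ⊗ and shifts of [] leave trailing zeros, so polynomials are
-- compared coefficientwise; the record lets Agda infer both sides of p ≈ r.
record _≈_ (p r : Poly) : Set where
  constructor coeffwise
  field coeff-≡ : p ≈ₚ r
open _≈_

infix 4 _≈_

≈-setoid : Setoid _ _
≈-setoid = record
  { Carrier = Poly
  ; _≈_ = _≈_
  ; isEquivalence = record
    { refl  = coeffwise λ _ → refl
    ; sym   = λ p≈r → coeffwise λ k → ≡.sym (coeff-≡ p≈r k)
    ; trans = λ p≈r r≈s → coeffwise λ k → ≡.trans (coeff-≡ p≈r k) (coeff-≡ r≈s k)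
    }
  }

open Setoid ≈-setoid using () renaming (refl to ≈-refl; trans to ≈-trans; reflexive to ≈-reflexive)
module ≈-Reasoning = Relation.Binary.Reasoning.Setoid ≈-setoid

coeff-⊕ : ∀ p r k → coeff (p ⊕ r) k ≡ coeff p k + coeff r k
coeff-⊕ []      r       k       = refl
coeff-⊕ (a ∷ p) []      k       = ≡.sym (+-identityʳ _)
coeff-⊕ (a ∷ p) (b ∷ r) zero    = refl
coeff-⊕ (a ∷ p) (b ∷ r) (suc k) = coeff-⊕ p r k

⊕-cong : ∀ {p p′ r r′} → p ≈ p′ → r ≈ r′ → p ⊕ r ≈ p′ ⊕ r′
⊕-cong {p} {p′} {r} {r′} p≈p′ r≈r′ = coeffwise λ k → begin
  coeff (p ⊕ r) k           ≡⟨ coeff-⊕ p r k ⟩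
  coeff p k + coeff r k     ≡⟨ cong₂ _+_ (coeff-≡ p≈p′ k) (coeff-≡ r≈r′ k) ⟩
  coeff p′ k + coeff r′ k   ≡⟨ coeff-⊕ p′ r′ k ⟨
  coeff (p′ ⊕ r′) k         ∎
  where open ≡.≡-Reasoning

∑-cong : ∀ {A : Set} {g h : A → Poly} {xs} → All (λ x → g x ≈ h x) xs → ∑ g xs ≈ ∑ h xs
∑-cong []             = ≈-refl
∑-cong (gx≈hx ∷ gxs≈hxs) = ⊕-cong gx≈hx (∑-cong gxs≈hxs)

shift : ℕ → Poly → Poly
shift a p = replicate a 0 ++ p

shift-+ : ∀ a b p → shift (a + b) p ≡ shift a (shift b p)
shift-+ zero    b p = refl
shift-+ (suc a) b p = cong (0 ∷_) (shift-+ a b p)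

shift-⊕ : ∀ a p r → shift a (p ⊕ r) ≡ shift a p ⊕ shift a r
shift-⊕ zero    p r = refl
shift-⊕ (suc a) p r = cong (0 ∷_) (shift-⊕ a p r)

shift-[] : ∀ a → shift a [] ≈ []
shift-[] zero    = ≈-refl
shift-[] (suc a) = coeffwise λ { zero → refl ; (suc k) → coeff-≡ (shift-[] a) k }

shift-cong : ∀ a {p r} → p ≈ r → shift a p ≈ shift a r
shift-cong zero    p≈r = p≈r
shift-cong (suc a) p≈r = coeffwise λ { zero → refl ; (suc k) → coeff-≡ (shift-cong a p≈r) k }

shift-∑ : ∀ {A : Set} a (g : A → Poly) xs → shift a (∑ g xs) ≈ (∑[ x ∈ xs ] shift a (g x))
shift-∑ a g []       = shift-[] a
shift-∑ a g (x ∷ xs) =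
  ≈-trans (≈-reflexive (shift-⊕ a (g x) (∑ g xs))) (⊕-cong ≈-refl (shift-∑ a g xs))

scale-1 : ∀ p → scale 1 p ≡ p
scale-1 []      = refl
scale-1 (a ∷ p) = cong₂ _∷_ (*-identityˡ a) (scale-1 p)

qint-⊗ : ∀ b r → qint b ⊗ r ≈ (∑[ k ∈ downFrom b ] shift k r)
qint-⊗ zero    r = ≈-refl
qint-⊗ (suc b) r = begin
  scale 1 r ⊕ shift 1 (qint b ⊗ r)
    ≡⟨ cong (_⊕ shift 1 (qint b ⊗ r)) (scale-1 r) ⟩
  r ⊕ shift 1 (qint b ⊗ r)
    ≈⟨ ⊕-cong ≈-refl (shift-cong 1 (qint-⊗ b r)) ⟩
  r ⊕ shift 1 (∑[ k ∈ downFrom b ] shift k r)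
    ≈⟨ ⊕-cong ≈-refl (shift-∑ 1 (λ k → shift k r) (downFrom b)) ⟩
  r ⊕ (∑[ k ∈ downFrom b ] shift (suc k) r)
    ≡⟨ cong (r ⊕_) (∑-map (λ k → shift k r) suc (downFrom b)) ⟨
  ∑[ k ∈ 0 ∷ map suc (downFrom b) ] shift k r
    ≡⟨ ∑-↭ (λ k → shift k r) (∷↭∷ʳ 0 (map suc (downFrom b))) ⟩
  ∑[ k ∈ map suc (downFrom b) ∷ʳ 0 ] shift k r
    ≡⟨ cong (λ ks → ∑[ k ∈ ks ∷ʳ 0 ] shift k r) (map-downFrom suc b) ⟩
  ∑[ k ∈ applyDownFrom suc b ∷ʳ 0 ] shift k r
    ≡⟨ cong (∑ (λ k → shift k r)) (downFrom-∷ʳ b) ⟩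
  ∑[ k ∈ downFrom (suc b) ] shift k r
    ∎
  where open ≈-Reasoning

∑-shift-downFrom : ∀ a b r → (∑[ k ∈ downFrom b ] shift (a + k) r) ≈ shift a (qint b ⊗ r)
∑-shift-downFrom a b r = begin
  ∑[ k ∈ downFrom b ] shift (a + k) r      ≡⟨ cong sumP (map-cong (λ k → shift-+ a k r) (downFrom b)) ⟩
  ∑[ k ∈ downFrom b ] shift a (shift k r)  ≈⟨ shift-∑ a (λ k → shift k r) (downFrom b) ⟨
  shift a (∑[ k ∈ downFrom b ] shift k r)  ≈⟨ shift-cong a (qint-⊗ b r) ⟨
  shift a (qint b ⊗ r)                     ∎
  where open ≈-Reasoning

-- Permutations by insertion

module _ {A B : Set} where

  concatMap-↭ : ∀ (f : A → List B) {xs ys} → xs ↭ ys → concatMap f xs ↭ concatMap f ys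
  concatMap-↭ f refl         = ↭-refl
  concatMap-↭ f (prep x p)   = ++⁺ˡ (f x) (concatMap-↭ f p)
  concatMap-↭ f (swap x y p) =
    ↭-trans (shifts (f x) (f y)) (++⁺ˡ (f y) (++⁺ˡ (f x) (concatMap-↭ f p)))
  concatMap-↭ f (trans p q)  = ↭-trans (concatMap-↭ f p) (concatMap-↭ f q)

  concatMap-cong-↭ : ∀ {f g : A → List B} → (∀ x → f x ↭ g x) →
                     ∀ xs → concatMap f xs ↭ concatMap g xs
  concatMap-cong-↭ f↭g []       = ↭-refl
  concatMap-cong-↭ f↭g (x ∷ xs) = ++⁺ (f↭g x) (concatMap-cong-↭ f↭g xs)

  concatMap-concatMap : ∀ {C : Set} (f : B → List C) (g : A → List B) xs →
                        concatMap f (concatMap g xs) ≡ concatMap (λ x → concatMap f (g x)) xs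
  concatMap-concatMap f g []       = refl
  concatMap-concatMap f g (x ∷ xs) =
    ≡.trans (concatMap-++ f (g x) (concatMap g xs))
            (cong (concatMap f (g x) ++_) (concatMap-concatMap f g xs))

module _ {n : ℕ} where

  private
    I : Fin n → List (Fin n) → List (List (Fin n))
    I = insertions

  insertions-↭ : ∀ x L → All (_↭ x ∷ L) (I x L)
  insertions-↭ x []      = ↭-refl ∷ []
  insertions-↭ x (y ∷ L) =
    ↭-refl ∷ AllP.map⁺ (All.map (λ σ↭ → ↭-trans (prep y σ↭) (swap y x ↭-refl))
                                (insertions-↭ x L))

  perms-↭ : ∀ xs → All (_↭ xs) (perms xs)
  perms-↭ []       = ↭-refl ∷ []
  perms-↭ (x ∷ xs) = AllP.concat⁺ (AllP.map⁺ (All.map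
    (λ {τ} τ↭ → All.map (λ σ↭ → ↭-trans σ↭ (prep x τ↭)) (insertions-↭ x τ))
    (perms-↭ xs)))

  concatMap-insertions-∷ : ∀ x z W →
    concatMap (I x) (map (z ∷_) W) ↭ map (x ∷_) (map (z ∷_) W) ++ map (z ∷_) (concatMap (I x) W)
  concatMap-insertions-∷ x z []      = ↭-refl
  concatMap-insertions-∷ x z (σ ∷ W) = prep (x ∷ z ∷ σ) (begin
    map (z ∷_) (I x σ) ++ concatMap (I x) (map (z ∷_) W)
      ↭⟨ ++⁺ˡ (map (z ∷_) (I x σ)) (concatMap-insertions-∷ x z W) ⟩
    map (z ∷_) (I x σ) ++ X ++ map (z ∷_) (concatMap (I x) W)
      ↭⟨ shifts (map (z ∷_) (I x σ)) X ⟩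
    X ++ map (z ∷_) (I x σ) ++ map (z ∷_) (concatMap (I x) W)
      ≡⟨ cong (X ++_) (map-++ (z ∷_) (I x σ) (concatMap (I x) W)) ⟨
    X ++ map (z ∷_) (I x σ ++ concatMap (I x) W)
      ∎)
    where
    open PermutationReasoning
    X = map (x ∷_) (map (z ∷_) W)

  insertions-comm : ∀ x y τ → concatMap (I x) (I y τ) ↭ concatMap (I y) (I x τ)
  insertions-comm x y []      = swap (x ∷ y ∷ []) (y ∷ x ∷ []) ↭-refl
  insertions-comm x y (z ∷ τ) = begin
    concatMap (I x) (I y (z ∷ τ))
      ↭⟨ prep _ (prep _ (++⁺ˡ Y (concatMap-insertions-∷ x z (I y τ)))) ⟩
    (x ∷ y ∷ z ∷ τ) ∷ (y ∷ x ∷ z ∷ τ) ∷ Y ++ X ++ map (z ∷_) (concatMap (I x) (I y τ))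
      ↭⟨ swap _ _ (shifts Y X) ⟩
    (y ∷ x ∷ z ∷ τ) ∷ (x ∷ y ∷ z ∷ τ) ∷ X ++ Y ++ map (z ∷_) (concatMap (I x) (I y τ))
      ↭⟨ prep _ (prep _ (++⁺ˡ X (++⁺ˡ Y (map⁺ (z ∷_) (insertions-comm x y τ))))) ⟩
    (y ∷ x ∷ z ∷ τ) ∷ (x ∷ y ∷ z ∷ τ) ∷ X ++ Y ++ map (z ∷_) (concatMap (I y) (I x τ))
      ↭⟨ prep _ (prep _ (++⁺ˡ X (concatMap-insertions-∷ y z (I x τ)))) ⟨
    concatMap (I y) (I x (z ∷ τ))
      ∎
    where
    open PermutationReasoning
    X = map (x ∷_) (map (z ∷_) (I y τ))
    Y = map (y ∷_) (map (z ∷_) (I x τ))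

  perms-∷ʳ : ∀ xs x → perms (xs ∷ʳ x) ↭ concatMap (I x) (perms xs)
  perms-∷ʳ []       x = ↭-refl
  perms-∷ʳ (y ∷ xs) x = begin
    concatMap (I y) (perms (xs ∷ʳ x))
      ↭⟨ concatMap-↭ (I y) (perms-∷ʳ xs x) ⟩
    concatMap (I y) (concatMap (I x) (perms xs))
      ≡⟨ concatMap-concatMap (I y) (I x) (perms xs) ⟩
    concatMap (λ τ → concatMap (I y) (I x τ)) (perms xs)
      ↭⟨ concatMap-cong-↭ (insertions-comm y x) (perms xs) ⟩
    concatMap (λ τ → concatMap (I x) (I y τ)) (perms xs)
      ≡⟨ concatMap-concatMap (I x) (I y) (perms xs) ⟨
    concatMap (I x) (concatMap (I y) (perms xs))
      ∎
    where open PermutationReasoning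

true≢false : true ≢ false
true≢false ()

true-or-false : ∀ b → b ≡ true ⊎ b ≡ false
true-or-false true  = inj₁ refl
true-or-false false = inj₂ refl

map-+-+ : ∀ a b ks → map (a +_) (map (b +_) ks) ≡ map (a + b +_) ks
map-+-+ a b ks = ≡.trans (≡.sym (map-∘ ks)) (map-cong (λ k → ≡.sym (+-assoc a b k)) ks)

module _ {A : Set} (p : A → Bool) where

  filterᵇ-accept : ∀ {x} xs → p x ≡ true → filterᵇ p (x ∷ xs) ≡ x ∷ filterᵇ p xs
  filterᵇ-accept _ px = filter-accept (T? ∘ p) (Equivalence.from T-≡ px)

  filterᵇ-reject : ∀ {x} xs → p x ≡ false → filterᵇ p (x ∷ xs) ≡ filterᵇ p xs
  filterᵇ-reject _ px = filter-reject (T? ∘ p) (≡.subst T px)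

  filterᵇ-map : ∀ {B : Set} {q : B → Bool} (f : B → A) → (∀ x → p (f x) ≡ q x) →
                ∀ xs → filterᵇ p (map f xs) ≡ map f (filterᵇ q xs)
  filterᵇ-map f pf≡q []       = refl
  filterᵇ-map {q = q} f pf≡q (x ∷ xs) with q x in qx
  ... | true  = ≡.trans (filterᵇ-accept _ (≡.trans (pf≡q x) qx))
                        (cong (f x ∷_) (filterᵇ-map f pf≡q xs))
  ... | false = ≡.trans (filterᵇ-reject _ (≡.trans (pf≡q x) qx)) (filterᵇ-map f pf≡q xs)

module _ {n : ℕ} (p : Fin n → Bool) where

  count-accept : ∀ {x} xs → p x ≡ true → count p (x ∷ xs) ≡ suc (count p xs)
  count-accept xs px = cong length (filterᵇ-accept p xs px)

  count-reject : ∀ {x} xs → p x ≡ false → count p (x ∷ xs) ≡ count p xs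
  count-reject xs px = cong length (filterᵇ-reject p xs px)

  count-↭ : ∀ {xs ys} → xs ↭ ys → count p xs ≡ count p ys
  count-↭ xs↭ys = ↭-length (filter-↭ (T? ∘ p) xs↭ys)

  count-∷-cong : ∀ x {xs ys} → count p xs ≡ count p ys → count p (x ∷ xs) ≡ count p (x ∷ ys)
  count-∷-cong x eq with p x
  ... | true  = cong suc eq
  ... | false = eq

  count-∷ʳ-reject : ∀ {x} xs → p x ≡ false → count p (xs ∷ʳ x) ≡ count p xs
  count-∷ʳ-reject {x} xs px = ≡.trans (count-↭ (↭-sym (∷↭∷ʳ x xs))) (count-reject xs px)

AllPairs-∷ʳ⁻ : ∀ {A : Set} {R : A → A → Set} xs {x} →
               AllPairs R (xs ∷ʳ x) → AllPairs R xs × All (λ y → R y x) xs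
AllPairs-∷ʳ⁻ []       _            = [] , []
AllPairs-∷ʳ⁻ (y ∷ xs) (Ry ∷ Rxs) =
  let Rxs′ , Rx = AllPairs-∷ʳ⁻ xs Rxs
      Ry′ , Ryx = AllP.∷ʳ⁻ Ry
  in (Ry′ ∷ Rxs′) , (Ryx ∷ Rx)

module _ {n : ℕ} where

  <ᵥ-reflects : (i j : Fin n) → Reflects (i < j) (i <ᵥ j)
  <ᵥ-reflects i j = <ᵇ-reflects-< (toℕ i) (toℕ j)

  <ᵥ-true : ∀ {i j : Fin n} → i < j → (i <ᵥ j) ≡ true
  <ᵥ-true i<j = Equivalence.to T-≡ (<⇒<ᵇ i<j)

  <ᵥ-false : ∀ {i j : Fin n} → j ≤ i → (i <ᵥ j) ≡ false
  <ᵥ-false {i} {j} j≤i with i <ᵥ j | <ᵥ-reflects i j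
  ... | true  | ofʸ i<j = ⊥-elim (<⇒≱ i<j j≤i)
  ... | false | _       = refl

  aboveMin-∷ʳ : ∀ {y₀ m : Fin n} ys → y₀ < m →
                aboveMin (y₀ ∷ ys ∷ʳ m) ≡ aboveMin (y₀ ∷ ys) ∷ʳ m
  aboveMin-∷ʳ {y₀} {m} ys y₀<m =
    ≡.trans (filter-++ (T? ∘ (y₀ <ᵥ_)) (y₀ ∷ ys) [ m ])
            (cong (aboveMin (y₀ ∷ ys) ++_) (filterᵇ-accept (y₀ <ᵥ_) [] (<ᵥ-true y₀<m)))

  tabulate-increasing : ∀ {k} (f : Fin k → Fin n) → (∀ {i j} → i < j → f i < f j) →
                        AllPairs _<_ (tabulate f)
  tabulate-increasing {zero}  f mono = []
  tabulate-increasing {suc k} f mono =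
    AllP.tabulate⁺ (λ _ → mono z<s) ∷ tabulate-increasing (f ∘ Fin.suc) (λ i<j → mono (s<s i<j))

  elems-increasing : (A : Subset n) → AllPairs _<_ (elems A)
  elems-increasing A = AllPairsP.filter⁺ (_∈? A) (tabulate-increasing id id)

  elems-nonempty : (A : Subset n) → Nonempty A → elems A ≢ []
  elems-nonempty A (x , x∈A) elems≡[]
    with ≡.subst (x ∈_) elems≡[] (∈-filter⁺ (_∈? A) (∈-allFin x) x∈A)
  ... | ()

-- Tree lists

module TreeLists {n : ℕ} (E : Graph n)
  (naturalUnitInterval : ∀ i j k → i < j → j < k → E i k ≡ true →
                         (E i j ≡ true) × (E j k ≡ true))
  where

  lowerNbr : Fin n → Fin n → Bool
  lowerNbr i j = (j <ᵥ i) ∧ E j i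

  lowerNbr-≤ : ∀ {i j} → i ≤ j → lowerNbr i j ≡ false
  lowerNbr-≤ {i} {j} i≤j = cong (_∧ E j i) (<ᵥ-false i≤j)

  descentOK : Fin n → Fin n → Bool
  descentOK x y = if y <ᵥ x then E y x else true

  risingOK : Fin n → Fin n → Bool
  risingOK M y = if M <ᵥ y then E M y else true

  _⊔ᵥ_ : Fin n → Fin n → Fin n
  M ⊔ᵥ y = if M <ᵥ y then y else M

  -- σ may follow a prefix of a tree list whose last entry is x and whose largest entry is M.
  suffixOK : Fin n → Fin n → List (Fin n) → Bool
  suffixOK x M σ = descentsOK E (x ∷ σ) ∧ chainOK E (M ∷ ltrMaxFrom M σ)

  isTreeListOf : List (Fin n) → List (Fin n) → Bool
  isTreeListOf xs σ = sameHead σ xs ∧ descentsOK E σ ∧ chainOK E (ltrMax σ)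

  suffixOK-∷ : ∀ x M y σ →
               suffixOK x M (y ∷ σ) ≡ (descentOK x y ∧ risingOK M y) ∧ suffixOK y (M ⊔ᵥ y) σ
  suffixOK-∷ x M y σ with M <ᵥ y
  ... | true  = interchange (descentOK x y) (descentsOK E (y ∷ σ))
                            (E M y) (chainOK E (y ∷ ltrMaxFrom y σ))
  ... | false = interchange (descentOK x y) (descentsOK E (y ∷ σ))
                            true (chainOK E (M ∷ ltrMaxFrom M σ))

  suffixOK-∷⁻ : ∀ x M y σ → suffixOK x M (y ∷ σ) ≡ true →
                (descentOK x y ∧ risingOK M y ≡ true) × (suffixOK y (M ⊔ᵥ y) σ ≡ true)
  suffixOK-∷⁻ x M y σ ok = ∧-conicalˡ step rest ok′ , ∧-conicalʳ step rest ok′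
    where
    step = descentOK x y ∧ risingOK M y
    rest = suffixOK y (M ⊔ᵥ y) σ
    ok′ = ≡.trans (≡.sym (suffixOK-∷ x M y σ)) ok

  module InsertMax (m : Fin n) where

    private
      I : List (Fin n) → List (List (Fin n))
      I = insertions m

    nbrCount : List (Fin n) → ℕ
    nbrCount = count (lowerNbr m)

    nbr-upward : ∀ {i j} → i ≤ j → j < m → E i m ≡ true → E j m ≡ true
    nbr-upward {i} {j} i≤j j<m eim with m≤n⇒m<n∨m≡n i≤j
    ... | inj₁ i<j = proj₂ (naturalUnitInterval i j m i<j j<m eim)
    ... | inj₂ i≡j = ≡.subst (λ k → E k m ≡ true) (toℕ-injective i≡j) eim

    lowerNbr-below : ∀ {j} → j < m → lowerNbr m j ≡ E j m
    lowerNbr-below {j} j<m = cong (_∧ E j m) (<ᵥ-true j<m)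

    descentOK-from-max : ∀ {y} → y < m → descentOK m y ≡ E y m
    descentOK-from-max {y} y<m = cong (if_then E y m else true) (<ᵥ-true y<m)

    descentOK-below : ∀ {x y} → x < m → E y m ≡ true → descentOK x y ≡ true
    descentOK-below {x} {y} x<m eym with y <ᵥ x | <ᵥ-reflects y x
    ... | true  | ofʸ y<x = proj₁ (naturalUnitInterval y x m y<x x<m eym)
    ... | false | _       = refl

    ⊔ᵥ-below : ∀ {M y} → M < m → y < m → (M ⊔ᵥ y) < m
    ⊔ᵥ-below {M} {y} M<m y<m with M <ᵥ y
    ... | true  = y<m
    ... | false = M<m

    ltrMaxFrom-max : ∀ {σ} → All (_< m) σ → ltrMaxFrom m σ ≡ []
    ltrMaxFrom-max []                   = refl
    ltrMaxFrom-max {x ∷ σ} (x<m ∷ σ<m) rewrite <ᵥ-false {i = m} {x} (<⇒≤ x<m) = ltrMaxFrom-max σ<m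

    suffixOK-max : ∀ {x M} σ → x < m → M < m → All (_< m) σ →
                   suffixOK x M (m ∷ σ) ≡ descentsOK E (m ∷ σ) ∧ E M m
    suffixOK-max {x} {M} σ x<m M<m σ<m
      rewrite <ᵥ-false {i = m} {x} (<⇒≤ x<m) | <ᵥ-true M<m | ltrMaxFrom-max σ<m =
        cong (descentsOK E (m ∷ σ) ∧_) (∧-identityʳ (E M m))

    chainOK-below : ∀ {M} σ → M < m → All (_< m) σ → E M m ≡ true →
                    chainOK E (M ∷ ltrMaxFrom M σ) ≡ true
    chainOK-below []      M<m []            eMm = refl
    chainOK-below {M} (y ∷ σ) M<m (y<m ∷ σ<m) eMm with M <ᵥ y | <ᵥ-reflects M y
    ... | true  | ofʸ M<y = let eMy , eym = naturalUnitInterval M y m M<y y<m eMm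
                            in cong₂ _∧_ eMy (chainOK-below σ y<m σ<m eym)
    ... | false | _       = chainOK-below σ M<m σ<m eMm

    suffixOK-deleteMax : ∀ {x M σ} L → x < m → M < m → All (_< m) L →
                         σ ∈ I L → suffixOK x M σ ≡ true → suffixOK x M L ≡ true
    suffixOK-deleteMax []      _   _   _             _           _  = refl
    suffixOK-deleteMax {x} {M} (y ∷ L) x<m M<m (y<m ∷ L<m) (here refl) ok =
      cong₂ _∧_ (cong₂ _∧_ (descentOK-below x<m eym) (∧-conicalʳ _ _ descents))
                (chainOK-below (y ∷ L) M<m (y<m ∷ L<m) eMm)
      where
      ok′ : descentsOK E (m ∷ y ∷ L) ∧ E M m ≡ true
      ok′ = ≡.trans (≡.sym (suffixOK-max (y ∷ L) x<m M<m (y<m ∷ L<m))) ok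
      descents = ∧-conicalˡ _ _ ok′
      eMm = ∧-conicalʳ _ _ ok′
      eym = ≡.trans (≡.sym (descentOK-from-max y<m)) (∧-conicalˡ _ _ descents)
    suffixOK-deleteMax {x} {M} (y ∷ L) x<m M<m (y<m ∷ L<m) (there σ∈) ok with ∈-map⁻ (y ∷_) σ∈
    ... | σ′ , σ′∈ , refl =
      let stepOK , restOK = suffixOK-∷⁻ x M y σ′ ok
      in ≡.trans (suffixOK-∷ x M y L)
           (cong₂ _∧_ stepOK (suffixOK-deleteMax L y<m (⊔ᵥ-below M<m y<m) L<m σ′∈ restOK))

    insertMax-rejected : ∀ {x M} L → x < m → M < m → All (_< m) L →
                         suffixOK x M L ≡ false → filterᵇ (suffixOK x M) (I L) ≡ []
    insertMax-rejected {x} {M} L x<m M<m L<m notOK =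
      filter-none (T? ∘ suffixOK x M) (All.tabulate λ σ∈ t → true≢false
        (≡.trans (≡.sym (suffixOK-deleteMax L x<m M<m L<m σ∈ (Equivalence.to T-≡ t))) notOK))

    nbrCount-both : ∀ {M y} L → M < m → y < m → E y m ∧ E M m ≡ true →
      nbrCount (M ∷ y ∷ L) ≡ suc (nbrCount ((M ⊔ᵥ y) ∷ L))
      × nbrCount (y ∷ L) ≡ nbrCount ((M ⊔ᵥ y) ∷ L)
    nbrCount-both {M} {y} L M<m y<m both =
      ≡.trans (count-accept (lowerNbr m) (y ∷ L) nbrM) (cong suc (≡.sym top)) , ≡.sym top
      where
      nbrM = ≡.trans (lowerNbr-below M<m) (∧-conicalʳ (E y m) (E M m) both)
      nbrY = ≡.trans (lowerNbr-below y<m) (∧-conicalˡ (E y m) (E M m) both)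
      top : nbrCount ((M ⊔ᵥ y) ∷ L) ≡ nbrCount (y ∷ L)
      top with M <ᵥ y
      ... | true  = refl
      ... | false = ≡.trans (count-accept (lowerNbr m) L nbrM) (≡.sym (count-accept (lowerNbr m) L nbrY))

    nbrCount-notBoth : ∀ {M y} L → M < m → y < m → E y m ∧ E M m ≡ false →
                       nbrCount (M ∷ y ∷ L) ≡ nbrCount ((M ⊔ᵥ y) ∷ L)
    nbrCount-notBoth {M} {y} L M<m y<m notBoth with M <ᵥ y | <ᵥ-reflects M y
    ... | true  | ofʸ M<y = count-reject (lowerNbr m) (y ∷ L) (≡.trans (lowerNbr-below M<m) eMm)
      where
      eMm : E M m ≡ false
      eMm = ¬-not λ e → true≢false
        (≡.trans (≡.sym (cong₂ _∧_ (proj₂ (naturalUnitInterval M y m M<y y<m e)) e)) notBoth)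
    ... | false | ofⁿ M≮y =
      count-∷-cong (lowerNbr m) M (count-reject (lowerNbr m) L (≡.trans (lowerNbr-below y<m) eym))
      where
      eym : E y m ≡ false
      eym = ¬-not λ e → true≢false
        (≡.trans (≡.sym (cong₂ _∧_ e (nbr-upward (≮⇒≥ M≮y) M<m e))) notBoth)

    suffixOK-insertHead : ∀ {x M y} L → x < m → M < m → y < m → All (_< m) L →
                          suffixOK x M (y ∷ L) ≡ true → suffixOK x M (m ∷ y ∷ L) ≡ E y m ∧ E M m
    suffixOK-insertHead {x} {M} {y} L x<m M<m y<m L<m ok = begin
      suffixOK x M (m ∷ y ∷ L)
        ≡⟨ suffixOK-max (y ∷ L) x<m M<m (y<m ∷ L<m) ⟩
      (descentOK m y ∧ descentsOK E (y ∷ L)) ∧ E M m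
        ≡⟨ cong (λ b → (b ∧ descentsOK E (y ∷ L)) ∧ E M m) (descentOK-from-max y<m) ⟩
      (E y m ∧ descentsOK E (y ∷ L)) ∧ E M m
        ≡⟨ cong (λ b → (E y m ∧ b) ∧ E M m) descentsOK-y ⟩
      (E y m ∧ true) ∧ E M m
        ≡⟨ cong (_∧ E M m) (∧-identityʳ (E y m)) ⟩
      E y m ∧ E M m
        ∎
      where
      open ≡.≡-Reasoning
      descentsOK-y = ∧-conicalˡ (descentsOK E (y ∷ L)) _ (proj₂ (suffixOK-∷⁻ x M y L ok))

    map-invG-∷ : ∀ {y} p L → y < m →
      map (invG E) (map (y ∷_) (filterᵇ p (I L)))
        ≡ map (count (lowerNbr y) L +_) (map (invG E) (filterᵇ p (I L)))
    map-invG-∷ {y} p L y<m = begin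
      map (invG E) (map (y ∷_) F)                    ≡⟨ map-∘ F ⟨
      map (λ σ → invG E (y ∷ σ)) F                   ≡⟨ map-cong-local (AllP.filter⁺ (T? ∘ p) invG-∷) ⟩
      map (λ σ → count (lowerNbr y) L + invG E σ) F  ≡⟨ map-∘ F ⟩
      map (count (lowerNbr y) L +_) (map (invG E) F) ∎
      where
      open ≡.≡-Reasoning
      F = filterᵇ p (I L)
      m-not-below-y = count-reject (lowerNbr y) L (lowerNbr-≤ (<⇒≤ y<m))
      invG-∷ : All (λ σ → invG E (y ∷ σ) ≡ count (lowerNbr y) L + invG E σ) (I L)
      invG-∷ = All.map (λ {σ} σ↭ → cong (_+ invG E σ) (≡.trans (count-↭ (lowerNbr y) σ↭) m-not-below-y))
                       (insertions-↭ m L)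

    insertMax-invs : ∀ {x M} L → x < m → M < m → All (_< m) L → suffixOK x M L ≡ true →
      map (invG E) (filterᵇ (suffixOK x M) (I L)) ≡ map (invG E L +_) (downFrom (nbrCount (M ∷ L)))

    insertMax-invs-∷ : ∀ {x M y} L → x < m → M < m → y < m → All (_< m) L → suffixOK x M L ≡ true →
      map (invG E) (map (y ∷_) (filterᵇ (suffixOK x M) (I L)))
        ≡ map (invG E (y ∷ L) +_) (downFrom (nbrCount (M ∷ L)))
    insertMax-invs-∷ {x} {M} {y} L x<m M<m y<m L<m ok = begin
      map (invG E) (map (y ∷_) (filterᵇ (suffixOK x M) (I L)))
        ≡⟨ map-invG-∷ (suffixOK x M) L y<m ⟩
      map (c +_) (map (invG E) (filterᵇ (suffixOK x M) (I L)))
        ≡⟨ cong (map (c +_)) (insertMax-invs L x<m M<m L<m ok) ⟩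
      map (c +_) (map (invG E L +_) (downFrom (nbrCount (M ∷ L))))
        ≡⟨ map-+-+ c (invG E L) (downFrom (nbrCount (M ∷ L))) ⟩
      map (invG E (y ∷ L) +_) (downFrom (nbrCount (M ∷ L)))
        ∎
      where
      open ≡.≡-Reasoning
      c = count (lowerNbr y) L

    insertMax-invs-after : ∀ {x M y} L → x < m → M < m → y < m → All (_< m) L →
      suffixOK x M (y ∷ L) ≡ true →
      map (invG E) (filterᵇ (suffixOK x M) (map (y ∷_) (I L)))
        ≡ map (invG E (y ∷ L) +_) (downFrom (nbrCount ((M ⊔ᵥ y) ∷ L)))
    insertMax-invs-after {x} {M} {y} L x<m M<m y<m L<m ok =
      ≡.trans (cong (map (invG E)) (filterᵇ-map (suffixOK x M) (y ∷_) suffixOK-y (I L)))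
              (insertMax-invs-∷ L y<m (⊔ᵥ-below M<m y<m) y<m L<m restOK)
      where
      stepOK = proj₁ (suffixOK-∷⁻ x M y L ok)
      restOK = proj₂ (suffixOK-∷⁻ x M y L ok)
      suffixOK-y : ∀ σ → suffixOK x M (y ∷ σ) ≡ suffixOK y (M ⊔ᵥ y) σ
      suffixOK-y σ = ≡.trans (suffixOK-∷ x M y σ) (cong (_∧ suffixOK y (M ⊔ᵥ y) σ) stepOK)

    insertMax-invs {x} {M} [] x<m M<m [] _ with true-or-false (E M m)
    ... | inj₁ eMm = begin
      map (invG E) (filterᵇ (suffixOK x M) ((m ∷ []) ∷ []))
        ≡⟨ cong (map (invG E)) (filterᵇ-accept (suffixOK x M) {m ∷ []} [] (≡.trans okM eMm)) ⟩
      0 ∷ []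
        ≡⟨ cong (λ k → map (0 +_) (downFrom k)) (count-accept (lowerNbr m) [] (≡.trans nbrM eMm)) ⟨
      map (0 +_) (downFrom (nbrCount (M ∷ [])))
        ∎
      where
      open ≡.≡-Reasoning
      okM = suffixOK-max [] x<m M<m []
      nbrM = lowerNbr-below M<m
    ... | inj₂ eMm = begin
      map (invG E) (filterᵇ (suffixOK x M) ((m ∷ []) ∷ []))
        ≡⟨ cong (map (invG E)) (filterᵇ-reject (suffixOK x M) {m ∷ []} [] (≡.trans okM eMm)) ⟩
      []
        ≡⟨ cong (λ k → map (0 +_) (downFrom k)) (count-reject (lowerNbr m) [] (≡.trans nbrM eMm)) ⟨
      map (0 +_) (downFrom (nbrCount (M ∷ [])))
        ∎
      where
      open ≡.≡-Reasoning
      okM = suffixOK-max [] x<m M<m []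
      nbrM = lowerNbr-below M<m
    insertMax-invs {x} {M} (y ∷ L) x<m M<m (y<m ∷ L<m) ok with true-or-false (E y m ∧ E M m)
    ... | inj₁ both = begin
      map (invG E) (filterᵇ (suffixOK x M) (I (y ∷ L)))
        ≡⟨ cong (map (invG E)) (filterᵇ-accept (suffixOK x M) {m ∷ y ∷ L} _ (≡.trans head both)) ⟩
      invG E (m ∷ y ∷ L) ∷ map (invG E) (filterᵇ (suffixOK x M) (map (y ∷_) (I L)))
        ≡⟨ cong₂ _∷_ (≡.trans (cong (_+ invG E (y ∷ L)) (proj₂ counts)) (+-comm K′ _))
                     (insertMax-invs-after L x<m M<m y<m L<m ok) ⟩
      map (invG E (y ∷ L) +_) (downFrom (suc K′))
        ≡⟨ cong (λ k → map (invG E (y ∷ L) +_) (downFrom k)) (proj₁ counts) ⟨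
      map (invG E (y ∷ L) +_) (downFrom (nbrCount (M ∷ y ∷ L)))
        ∎
      where
      open ≡.≡-Reasoning
      head = suffixOK-insertHead L x<m M<m y<m L<m ok
      K′ = nbrCount ((M ⊔ᵥ y) ∷ L)
      counts = nbrCount-both L M<m y<m both
    ... | inj₂ notBoth = begin
      map (invG E) (filterᵇ (suffixOK x M) (I (y ∷ L)))
        ≡⟨ cong (map (invG E)) (filterᵇ-reject (suffixOK x M) {m ∷ y ∷ L} _ (≡.trans head notBoth)) ⟩
      map (invG E) (filterᵇ (suffixOK x M) (map (y ∷_) (I L)))
        ≡⟨ insertMax-invs-after L x<m M<m y<m L<m ok ⟩
      map (invG E (y ∷ L) +_) (downFrom (nbrCount ((M ⊔ᵥ y) ∷ L)))
        ≡⟨ cong (λ k → map (invG E (y ∷ L) +_) (downFrom k)) (nbrCount-notBoth L M<m y<m notBoth) ⟨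
      map (invG E (y ∷ L) +_) (downFrom (nbrCount (M ∷ y ∷ L)))
        ∎
      where
      open ≡.≡-Reasoning
      head = suffixOK-insertHead L x<m M<m y<m L<m ok

    isTreeListOf-max : ∀ {y₀ zs σ} → y₀ < m → isTreeListOf (y₀ ∷ zs) (m ∷ σ) ≡ false
    isTreeListOf-max {y₀} {zs} {σ} y₀<m =
      cong (_∧ (descentsOK E (m ∷ σ) ∧ chainOK E (ltrMax (m ∷ σ))))
           (¬-not λ eq → <⇒≢ y₀<m (≡.sym (≡ᵇ⇒≡ (toℕ m) (toℕ y₀) (Equivalence.from T-≡ eq))))

    filterᵇ-isTreeListOf-insertMax : ∀ {y₀} ys y L → y₀ < m →
      filterᵇ (isTreeListOf (y₀ ∷ ys ∷ʳ m)) (I (y ∷ L))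
        ≡ map (y ∷_) (filterᵇ (λ σ → isTreeListOf (y₀ ∷ ys) (y ∷ σ)) (I L))
    filterᵇ-isTreeListOf-insertMax {y₀} ys y L y₀<m =
      ≡.trans (filterᵇ-reject P {m ∷ y ∷ L} _ (isTreeListOf-max {zs = ys ∷ʳ m} {σ = y ∷ L} y₀<m))
              (filterᵇ-map P (y ∷_) (λ _ → refl) (I L))
      where P = isTreeListOf (y₀ ∷ ys ∷ʳ m)

    treeList-insertMax-rejected : ∀ {y₀} ys τ → y₀ < m → All (_< m) τ →
      isTreeListOf (y₀ ∷ ys) τ ≡ false → filterᵇ (isTreeListOf (y₀ ∷ ys ∷ʳ m)) (I τ) ≡ []
    treeList-insertMax-rejected {y₀} ys []      y₀<m []          _ =
      filterᵇ-reject (isTreeListOf (y₀ ∷ ys ∷ʳ m)) {m ∷ []} []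
                     (isTreeListOf-max {zs = ys ∷ʳ m} {σ = []} y₀<m)
    treeList-insertMax-rejected {y₀} ys (y ∷ L) y₀<m (y<m ∷ L<m) notTL
      rewrite filterᵇ-isTreeListOf-insertMax ys y L y₀<m with toℕ y ≡ᵇ toℕ y₀
    ... | true  = cong (map (y ∷_)) (insertMax-rejected L y<m y<m L<m notTL)
    ... | false = cong (map (y ∷_)) (filter-none (T? ∘ λ _ → false) (All.universal (λ _ ()) (I L)))

    treeList-insertMax-accepted : ∀ {y₀} ys τ → y₀ < m → All (_< m) τ →
      isTreeListOf (y₀ ∷ ys) τ ≡ true →
      map (invG E) (filterᵇ (isTreeListOf (y₀ ∷ ys ∷ʳ m)) (I τ))
        ≡ map (invG E τ +_) (downFrom (nbrCount τ))
    treeList-insertMax-accepted ys [] _ _ ()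
    treeList-insertMax-accepted {y₀} ys (y ∷ L) y₀<m (y<m ∷ L<m) tl
      rewrite filterᵇ-isTreeListOf-insertMax ys y L y₀<m with toℕ y ≡ᵇ toℕ y₀
    ... | true  = insertMax-invs-∷ L y<m y<m y<m L<m tl
    ... | false = ⊥-elim (true≢false (≡.sym tl))

    ∑-treeList-insertMax : ∀ {y₀} ys {τ b} r → y₀ < m → All (_< m) τ → nbrCount τ ≡ b →
      (∑[ σ ∈ filterᵇ (isTreeListOf (y₀ ∷ ys ∷ʳ m)) (I τ) ] shift (invG E σ) r)
        ≈ (if isTreeListOf (y₀ ∷ ys) τ then shift (invG E τ) (qint b ⊗ r) else [])
    ∑-treeList-insertMax {y₀} ys {τ} {b} r y₀<m τ<m nbrCountτ
      with true-or-false (isTreeListOf (y₀ ∷ ys) τ)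
    ... | inj₁ tl rewrite tl = begin
      ∑[ σ ∈ F ] shift (invG E σ) r
        ≡⟨ ∑-map (λ k → shift k r) (invG E) F ⟨
      ∑[ k ∈ map (invG E) F ] shift k r
        ≡⟨ cong (∑ (λ k → shift k r)) invs ⟩
      ∑[ k ∈ map (invG E τ +_) (downFrom b) ] shift k r
        ≡⟨ ∑-map (λ k → shift k r) (invG E τ +_) (downFrom b) ⟩
      ∑[ k ∈ downFrom b ] shift (invG E τ + k) r
        ≈⟨ ∑-shift-downFrom (invG E τ) b r ⟩
      shift (invG E τ) (qint b ⊗ r)
        ∎
      where
      open ≈-Reasoning
      F = filterᵇ (isTreeListOf (y₀ ∷ ys ∷ʳ m)) (I τ)
      invs : map (invG E) F ≡ map (invG E τ +_) (downFrom b)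
      invs = ≡.trans (treeList-insertMax-accepted ys τ y₀<m τ<m tl)
                     (cong (λ k → map (invG E τ +_) (downFrom k)) nbrCountτ)
    ... | inj₂ notTL rewrite notTL =
      ≈-reflexive (cong (∑ (λ σ → shift (invG E σ) r)) (treeList-insertMax-rejected ys τ y₀<m τ<m notTL))

  ∏-aboveMin-∷ʳ : ∀ {y₀ m} ys r → All (_< m) (y₀ ∷ ys) →
    foldr _⊗_ (qint (count (lowerNbr m) (y₀ ∷ ys)) ⊗ r)
              (map (λ i → qint (count (lowerNbr i) (y₀ ∷ ys))) (aboveMin (y₀ ∷ ys)))
      ≡ foldr _⊗_ r (map (λ i → qint (count (lowerNbr i) (y₀ ∷ ys ∷ʳ m)))
                         (aboveMin (y₀ ∷ ys ∷ʳ m)))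
  ∏-aboveMin-∷ʳ {y₀} {m} ys r Y<m = begin
    foldr _⊗_ (b m ⊗ r) (map b (aboveMin Y))
      ≡⟨ foldr-∷ʳ _⊗_ r (b m) (map b (aboveMin Y)) ⟨
    foldr _⊗_ r (map b (aboveMin Y) ∷ʳ b m)
      ≡⟨ cong₂ (λ qs q → foldr _⊗_ r (qs ∷ʳ q)) (map-cong-local b≡b′)
                                                 (cong qint (count-∷ʳm ≤-refl)) ⟩
    foldr _⊗_ r (map b′ (aboveMin Y) ∷ʳ b′ m)
      ≡⟨ cong (foldr _⊗_ r) (map-++ b′ (aboveMin Y) [ m ]) ⟨
    foldr _⊗_ r (map b′ (aboveMin Y ∷ʳ m))
      ≡⟨ cong (λ is → foldr _⊗_ r (map b′ is)) (aboveMin-∷ʳ ys (All.head Y<m)) ⟨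
    foldr _⊗_ r (map b′ (aboveMin (Y ∷ʳ m)))
      ∎
    where
    open ≡.≡-Reasoning
    Y = y₀ ∷ ys
    b b′ : Fin n → Poly
    b i = qint (count (lowerNbr i) Y)
    b′ i = qint (count (lowerNbr i) (Y ∷ʳ m))
    count-∷ʳm : ∀ {i} → i ≤ m → count (lowerNbr i) Y ≡ count (lowerNbr i) (Y ∷ʳ m)
    count-∷ʳm {i} i≤m = ≡.sym (count-∷ʳ-reject (lowerNbr i) Y (lowerNbr-≤ i≤m))
    b≡b′ : All (λ i → b i ≡ b′ i) (aboveMin Y)
    b≡b′ = All.map (λ i<m → cong qint (count-∷ʳm (<⇒≤ i<m))) (AllP.filter⁺ (T? ∘ (y₀ <ᵥ_)) Y<m)

  -- The accumulator r absorbs the factor [b]_q of the maximum, so ⊗ never needs to commute.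
  ∑-treeLists : ∀ {xs} → Reverse xs → AllPairs _<_ xs → xs ≢ [] → ∀ r →
    (∑[ σ ∈ filterᵇ (isTreeListOf xs) (perms xs) ] shift (invG E σ) r)
      ≈ foldr _⊗_ r (map (λ i → qint (count (lowerNbr i) xs)) (aboveMin xs))
  ∑-treeLists [] _ nonempty r = ⊥-elim (nonempty refl)
  ∑-treeLists ([] ∶ _ ∶ʳ a) _ _ r = ≈-reflexive (begin
    ∑[ σ ∈ filterᵇ (isTreeListOf (a ∷ [])) ((a ∷ []) ∷ []) ] shift (invG E σ) r
      ≡⟨ cong (∑ (λ σ → shift (invG E σ) r))
              (filterᵇ-accept (isTreeListOf (a ∷ [])) {a ∷ []} [] single) ⟩
    r ⊕ []
      ≡⟨ ⊕-identityʳ r ⟩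
    r
      ≡⟨ cong (λ is → foldr _⊗_ r (map b is))
              (filterᵇ-reject (a <ᵥ_) {a} [] (<ᵥ-false {i = a} ≤-refl)) ⟨
    foldr _⊗_ r (map b (aboveMin (a ∷ [])))
      ∎)
    where
    open ≡.≡-Reasoning
    b : Fin n → Poly
    b i = qint (count (lowerNbr i) (a ∷ []))
    single : isTreeListOf (a ∷ []) (a ∷ []) ≡ true
    single = ≡.trans (∧-identityʳ _) (Equivalence.to T-≡ (≡⇒≡ᵇ (toℕ a) (toℕ a) refl))
  ∑-treeLists ((y₀ ∷ ys) ∶ rs ∶ʳ m) sorted _ r = begin
    ∑ g (filterᵇ P (perms (Y ∷ʳ m)))
      ≡⟨ ∑-filterᵇ g P (perms (Y ∷ʳ m)) ⟩
    ∑ gP (perms (Y ∷ʳ m))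
      ≡⟨ ∑-↭ gP (perms-∷ʳ Y m) ⟩
    ∑ gP (concatMap (insertions m) (perms Y))
      ≡⟨ ∑-concatMap gP (insertions m) (perms Y) ⟩
    (∑[ τ ∈ perms Y ] ∑ gP (insertions m τ))
      ≡⟨ cong sumP (map-cong (λ τ → ≡.sym (∑-filterᵇ g P (insertions m τ))) (perms Y)) ⟩
    (∑[ τ ∈ perms Y ] ∑ g (filterᵇ P (insertions m τ)))
      ≈⟨ ∑-cong (All.map insertMax (perms-↭ Y)) ⟩
    (∑[ τ ∈ perms Y ] (if isTreeListOf Y τ then shift (invG E τ) (qint b ⊗ r) else []))
      ≡⟨ ∑-filterᵇ (λ τ → shift (invG E τ) (qint b ⊗ r)) (isTreeListOf Y) (perms Y) ⟨
    (∑[ τ ∈ filterᵇ (isTreeListOf Y) (perms Y) ] shift (invG E τ) (qint b ⊗ r))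
      ≈⟨ ∑-treeLists rs (proj₁ (AllPairs-∷ʳ⁻ Y sorted)) (λ ()) (qint b ⊗ r) ⟩
    foldr _⊗_ (qint b ⊗ r) (map (λ i → qint (count (lowerNbr i) Y)) (aboveMin Y))
      ≡⟨ ∏-aboveMin-∷ʳ ys r Y<m ⟩
    foldr _⊗_ r (map (λ i → qint (count (lowerNbr i) (Y ∷ʳ m))) (aboveMin (Y ∷ʳ m)))
      ∎
    where
    open ≈-Reasoning
    open InsertMax m
    Y = y₀ ∷ ys
    Y<m = proj₂ (AllPairs-∷ʳ⁻ Y sorted)
    b = nbrCount Y
    P = isTreeListOf (Y ∷ʳ m)
    g gP : List (Fin n) → Poly
    g σ = shift (invG E σ) r
    gP σ = if P σ then g σ else []
    insertMax : ∀ {τ} → τ ↭ Y →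
      ∑ g (filterᵇ P (insertions m τ)) ≈ (if isTreeListOf Y τ then shift (invG E τ) (qint b ⊗ r) else [])
    insertMax τ↭Y =
      ∑-treeList-insertMax ys r (All.head Y<m) (All-resp-↭ (↭-sym τ↭Y) Y<m) (count-↭ (lowerNbr m) τ↭Y)

lemma3p13 : (n : ℕ) (E : Graph n)
    → (∀ i j → E i j ≡ E j i)
    → (∀ i → E i i ≡ false)
    → (∀ i j k → toℕ i ℕ.< toℕ j → toℕ j ℕ.< toℕ k → E i k ≡ true → (E i j ≡ true) × (E j k ≡ true))
    → (A : Subset n) → Nonempty A
    → sumP (map (λ σ → qpow (invG E σ)) (treeLists E A))
    ≈ₚ prodP (map (λ i → qint (bA E A i)) (aboveMin (elems A)))
lemma3p13 n E _ _ naturalUnitInterval A nonempty =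
  coeff-≡ (∑-treeLists (reverseView (elems A)) (elems-increasing A) (elems-nonempty A nonempty) one)
  where open TreeLists E naturalUnitInterval
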